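{- In the one-shuffle model with $n\ge1$ cards and $h=\lceil n/2\rceil$, let $F_A(q)=\sum_{a=0}^{h}\widetilde G(a,h-a,q)$ and $F_B(q)=\sum_{b=0}^{n-h}\widetilde G(b,n-h-b,q)$. Then for every integer $r\ge 0$, $$C[Y_A^r]=2^{\,n-h}\,D^{(r)}F_A(q)\big|_{q=1},\qquad C[Z_B^r]=2^{\,h}\,D^{(r)}F_B(q)\big|_{q=1}.$$
   Context: One-shuffle model. Fix an integer $n\ge 1$ (cards $1,\dots,n$ initially in increasing order). An outcome of one riffle shuffle is a pair $(t,S)$ with $t\in\{0,\dots,n\}$, $S\subseteq\{1,\dots,n\}$, $|S|=t$: first pile $A=(1,\dots,t)$, second pile $B=(t+1,\dots,n)$; the permutation $\pi$ has the elements of $A$ in increasing order at the positions of $S$ and those of $B$ in increasing order elsewhere. The $2^n$ outcomes are regarded as distinct even when they give the same permutation. For a function $W$ of the outcome, $C[W]$ is the sum of $W$ over all $2^n$ outcomes. Let $h=\lceil n/2\rceil$. Guesses: $g(i)=\lfloor i/2\rfloor+1$ at position $i\le h$, $g(j)=n-\lfloor (n+1-j)/2\rfloor$ at position $j\ge h+1$. $Y_A$ is the number of positions $i\le h$ such that $\pi(i)$ belongs to the first pile $A$ and $\pi(i)=g(i)$; $Z_B$ is the number of positions $j\ge h+1$ such that $\pi(j)$ belongs to the second pile $B$ and $\pi(j)=g(j)$. The polynomials $\widetilde G(a_1,a_2,q)$, for integers $a_1,a_2$, are defined by $\widetilde G(0,0,q)=1$, $\widetilde G(a_1,a_2,q)=0$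 if $a_1<0$ or $a_2<0$, and for $a_1,a_2\ge0$ with $a_1+a_2\ge1$: $\widetilde G(a_1,a_2,q)=q^{\delta(c,a_1)}\widetilde G(a_1-1,a_2,q)+\widetilde G(a_1,a_2-1,q)$ with $c=\lfloor (a_1+a_2)/2\rfloor+1$, where $\delta$ is the Kronecker delta. The operator $D$ acts by $(Dt)(q)=q\,t'(q)$ and $D^{(r)}$ is its $r$-fold iterate. -}

module Defs where

open import Data.Nat using (ℕ; zero; suc; _+_; _*_; _∸_; _^_; _≡ᵇ_; ⌊_/2⌋; ⌈_/2⌉)
open import Data.Bool using (Bool; true; false; if_then_else_; _∧_; not)
open import Data.Nat.ListAction using (sum)
open import Data.List using (List; []; _∷_; map; upTo; applyUpTo; filter; length; take; foldr)
open import Data.Vec using (Vec; []; _∷_; toList)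

-- Polynomials in q with natural-number coefficients, as coefficient
-- lists (head = coefficient of q^0).

Poly : Set
Poly = List ℕ

_+p_ : Poly → Poly → Poly
[]       +p q        = q
(a ∷ p)  +p []       = a ∷ p
(a ∷ p)  +p (b ∷ q)  = (a + b) ∷ (p +p q)

sumP : List Poly → Poly
sumP = foldr _+p_ []

qPow : Bool → Poly → Poly
qPow true  p = 0 ∷ p
qPow false p = p

-- the operator D t = q t'(q): coefficient of q^k gets multiplied by k
Dgo : ℕ → Poly → Poly
Dgo k []       = []
Dgo k (c ∷ cs) = (k * c) ∷ Dgo (suc k) cs

D : Poly → Poly
D = Dgo 0

Dpow : ℕ → Poly → Poly
Dpow zero    p = p
Dpow (suc r) p = D (Dpow r p)

eval1 : Poly → ℕ
eval1 = sum

-- G̃(a1,a2,q) for a1,a2 ≥ 0 (the values at negative arguments are 0,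
-- which is used in the a1 = 0 / a2 = 0 cases).

δc : ℕ → ℕ → Bool
δc a1 a2 = (⌊ (a1 + a2) /2⌋ + 1) ≡ᵇ a1

Gt : ℕ → ℕ → Poly
Gt zero    zero    = 1 ∷ []
Gt zero    (suc b) = [] +p Gt zero b
Gt (suc a) zero    = qPow (δc (suc a) zero) (Gt a zero) +p []
Gt (suc a) (suc b) = qPow (δc (suc a) (suc b)) (Gt a (suc b)) +p Gt (suc a) b

-- One-shuffle model.  An outcome is (t , S) with S ⊆ {1..n} encoded as
-- a Bool vector of length n (entry i-1 is true iff position i ∈ S).

allSubsets : (n : ℕ) → List (Vec Bool n)
allSubsets zero    = [] ∷ []
allSubsets (suc n) = map (true ∷_) (allSubsets n) Data.List.++ map (false ∷_) (allSubsets n)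
  where import Data.List

countB : Bool → List Bool → ℕ
countB b []       = 0
countB b (x ∷ xs) = (if (if b then x else not x) then 1 else 0) + countB b xs

card : {n : ℕ} → Vec Bool n → ℕ
card S = countB true (toList S)

nth : List Bool → ℕ → Bool
nth []       _       = false
nth (x ∷ xs) zero    = x
nth (x ∷ xs) (suc k) = nth xs k

inS : {n : ℕ} → Vec Bool n → ℕ → Bool
inS S i = nth (toList S) (i ∸ 1)

-- π(i): if i ∈ S, the (rank of i in S)-th element of A = (1..t);
-- otherwise the (rank of i in the complement)-th element of B = (t+1..n).
perm : {n : ℕ} → ℕ → Vec Bool n → ℕ → ℕ
perm t S i =
  if inS S i then countB true (take i (toList S))
             else t + countB false (take i (toList S))

C : (n : ℕ) → (ℕ → Vec Bool n → ℕ) → ℕ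
C n W = sum (map (λ t → sum (map (λ S → if card S ≡ᵇ t then W t S else 0)
                                 (allSubsets n)))
                 (upTo (suc n)))

hh : ℕ → ℕ
hh n = ⌈ n /2⌉

gA : ℕ → ℕ
gA i = ⌊ i /2⌋ + 1

gB : ℕ → ℕ → ℕ
gB n j = n ∸ ⌊ (n + 1 ∸ j) /2⌋

count : (ℕ → Bool) → List ℕ → ℕ
count p xs = length (filter (λ x → Data.Bool.T? (p x)) xs)
  where import Data.Bool

-- Y_A: positions i ∈ {1..h} with π(i) ∈ A (i.e. i ∈ S) and π(i) = g(i)
YA : (n : ℕ) → ℕ → Vec Bool n → ℕ
YA n t S = count (λ i → inS S i ∧ (perm t S i ≡ᵇ gA i)) (applyUpTo suc (hh n))

-- Z_B: positions j ∈ {h+1..n} with π(j) ∈ B (i.e. j ∉ S) and π(j) = g(j)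
ZB : (n : ℕ) → ℕ → Vec Bool n → ℕ
ZB n t S = count (λ j → not (inS S j) ∧ (perm t S j ≡ᵇ gB n j))
                 (applyUpTo (λ k → hh n + suc k) (n ∸ hh n))

FA : ℕ → Poly
FA n = sumP (map (λ a → Gt a (hh n ∸ a)) (upTo (suc (hh n))))

FB : ℕ → Poly
FB n = sumP (map (λ b → Gt b ((n ∸ hh n) ∸ b)) (upTo (suc (n ∸ hh n))))

module Submission where

-- Only the outcomes with t = |S| contribute, so C sums over the 2ⁿ words S ∈ {A,B}ⁿ.
-- Y_A depends only on the first h letters of S and Z_B only on the last n − h; on such a
-- block both count the letters of their pile that are the (⌊i/2⌋+1)-th letter of that pile
-- among the first i letters read from the outer end.  Sorting the words of length m by
-- their number a of pile letters, the recursion of G̃(a, m − a) is the decomposition by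
-- the innermost letter, the factor q recording a correct guess; so G̃(a, m − a) is the
-- generating polynomial of that count, and Dʳ evaluated at q = 1 yields its r-th moment.

open import Defs
open import Data.Nat using (ℕ; zero; suc; _+_; _*_; _∸_; _^_; _≡ᵇ_; ⌊_/2⌋; _≤_; _<_; z≤n; s≤s)
open import Data.Nat.Properties
open import Data.Nat.ListAction using (sum)
open import Data.Nat.ListAction.Properties using (sum-++)
open import Data.Bool using (Bool; true; false; if_then_else_; _∧_; not; T)
open import Data.List using (List; []; _∷_; map; _++_; _∷ʳ_; upTo; applyUpTo; take; drop; length; reverse)
open import Data.List.Properties
  using (map-++; map-∘; map-upTo; applyUpTo-∷ʳ; unfold-reverse; length-reverse; reverse-involutive; ∷ʳ-++; length-take; length-drop; length-++; take++drop≡id)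
open import Data.List.Relation.Unary.All as All using (All; []; _∷_)
open import Data.List.Relation.Unary.All.Properties using (all-upTo)
open import Data.Vec as Vec using (Vec; toList)
open import Data.Vec.Properties using (length-toList)
open import Data.Product using (_×_; _,_)
open import Data.Empty using (⊥-elim)
open import Function using (_∘_)
open import Algebra.Properties.CommutativeSemigroup +-commutativeSemigroup using (interchange)
open import Relation.Binary.PropositionalEquality
open ≡-Reasoning

toℕ : Bool → ℕ
toℕ b = if b then 1 else 0

≡ᵇ-cong-⇔ : ∀ {a b c d} → (a ≡ b → c ≡ d) → (c ≡ d → a ≡ b) → (a ≡ᵇ b) ≡ (c ≡ᵇ d)
≡ᵇ-cong-⇔ {a} {b} {c} {d} ⇒ ⇐ with a ≡ᵇ b in ab | c ≡ᵇ d in cd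
... | true  | true  = refl
... | false | false = refl
... | true  | false = ⊥-elim (subst T cd (≡⇒≡ᵇ c d (⇒ (≡ᵇ⇒≡ a b (subst T (sym ab) _)))))
... | false | true  = ⊥-elim (subst T ab (≡⇒≡ᵇ a b (⇐ (≡ᵇ⇒≡ c d (subst T (sym cd) _)))))

≡ᵇ-sym : ∀ a b → (a ≡ᵇ b) ≡ (b ≡ᵇ a)
≡ᵇ-sym a b = ≡ᵇ-cong-⇔ {a} {b} sym sym

<⇒≡ᵇ-false : ∀ {m n} → m < n → (m ≡ᵇ n) ≡ false
<⇒≡ᵇ-false {zero}  {suc n} _         = refl
<⇒≡ᵇ-false {suc m} {suc n} (s≤s m<n) = <⇒≡ᵇ-false m<n

if-≡ᵇ-cong : ∀ x a {u v : ℕ} → (x ≡ a → u ≡ v) →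
  (if x ≡ᵇ a then u else 0) ≡ (if x ≡ᵇ a then v else 0)
if-≡ᵇ-cong x a u≡v with x ≡ᵇ a in eq
... | true  = u≡v (≡ᵇ⇒≡ x a (subst T (sym eq) _))
... | false = refl

∑ : {A : Set} → List A → (A → ℕ) → ℕ
∑ xs f = sum (map f xs)

syntax ∑ xs (λ x → e) = ∑[ x ∈ xs ] e

∑-cong : {A : Set} (xs : List A) {f g : A → ℕ} → (∀ x → f x ≡ g x) → ∑ xs f ≡ ∑ xs g
∑-cong []       f≡g = refl
∑-cong (x ∷ xs) f≡g = cong₂ _+_ (f≡g x) (∑-cong xs f≡g)

∑-congᴬ : {A : Set} {xs : List A} {f g : A → ℕ} → All (λ x → f x ≡ g x) xs → ∑ xs f ≡ ∑ xs g
∑-congᴬ []          = refl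
∑-congᴬ (px ∷ pxs) = cong₂ _+_ px (∑-congᴬ pxs)

∑-zero : {A : Set} (xs : List A) → ∑[ x ∈ xs ] 0 ≡ 0
∑-zero []       = refl
∑-zero (x ∷ xs) = ∑-zero xs

∑-+ : {A : Set} (xs : List A) (f g : A → ℕ) → ∑[ x ∈ xs ] (f x + g x) ≡ ∑ xs f + ∑ xs g
∑-+ []       f g = refl
∑-+ (x ∷ xs) f g = trans (cong (f x + g x +_) (∑-+ xs f g)) (interchange (f x) (g x) (∑ xs f) (∑ xs g))

∑-swap : {A B : Set} (xs : List A) (ys : List B) (F : A → B → ℕ) →
  ∑[ x ∈ xs ] ∑[ y ∈ ys ] F x y ≡ ∑[ y ∈ ys ] ∑[ x ∈ xs ] F x y
∑-swap []       ys F = sym (∑-zero ys)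
∑-swap (x ∷ xs) ys F =
  trans (cong (∑ ys (F x) +_) (∑-swap xs ys F)) (sym (∑-+ ys (F x) (λ y → ∑[ x ∈ xs ] F x y)))

∑-++ : {A : Set} (xs ys : List A) (f : A → ℕ) → ∑ (xs ++ ys) f ≡ ∑ xs f + ∑ ys f
∑-++ xs ys f = trans (cong sum (map-++ f xs ys)) (sum-++ (map f xs) (map f ys))

∑-map : {A B : Set} (g : A → B) (xs : List A) (f : B → ℕ) → ∑ (map g xs) f ≡ ∑ xs (f ∘ g)
∑-map g xs f = cong sum (sym (map-∘ xs))

applyUpTo-cong : {A : Set} {f g : ℕ → A} → (∀ k → f k ≡ g k) → ∀ n → applyUpTo f n ≡ applyUpTo g n
applyUpTo-cong f≡g zero    = refl
applyUpTo-cong f≡g (suc n) = cong₂ _∷_ (f≡g 0) (applyUpTo-cong (f≡g ∘ suc) n)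

∑-upTo-select : ∀ m {c} (v : ℕ → ℕ) → c ≤ m → ∑[ t ∈ upTo (suc m) ] (if c ≡ᵇ t then v t else 0) ≡ v c
∑-upTo-select m v c≤m = trans (cong sum (map-upTo _ (suc m))) (select m v c≤m)
  where
  select : ∀ m {c} (v : ℕ → ℕ) → c ≤ m → sum (applyUpTo (λ t → if c ≡ᵇ t then v t else 0) (suc m)) ≡ v c
  select m       {zero}  v _         = begin
    v 0 + sum (applyUpTo (λ _ → 0) m) ≡⟨ cong (λ s → v 0 + sum s) (sym (map-upTo _ m)) ⟩
    v 0 + ∑[ t ∈ upTo m ] 0           ≡⟨ cong (v 0 +_) (∑-zero (upTo m)) ⟩
    v 0 + 0                           ≡⟨ +-identityʳ (v 0) ⟩
    v 0                               ∎
  select (suc m) {suc c} v (s≤s c≤m) = select m (v ∘ suc) c≤m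

count≡∑ : (p : ℕ → Bool) (xs : List ℕ) → count p xs ≡ ∑[ x ∈ xs ] toℕ (p x)
count≡∑ p []       = refl
count≡∑ p (x ∷ xs) with p x
... | true  = cong suc (count≡∑ p xs)
... | false = count≡∑ p xs

-- Σᵢ (k + i)ʳ pᵢ: the shift k absorbs the factors q^δ of G̃, and moment r 0 p = (Dʳ p)(1).
moment : ℕ → ℕ → Poly → ℕ
moment r k []       = 0
moment r k (c ∷ cs) = k ^ r * c + moment r (suc k) cs

sum≡moment-zero : ∀ k p → sum p ≡ moment 0 k p
sum≡moment-zero k []       = refl
sum≡moment-zero k (c ∷ cs) = cong₂ _+_ (sym (*-identityˡ c)) (sum≡moment-zero (suc k) cs)

moment-Dgo : ∀ r k p → moment r k (Dgo k p) ≡ moment (suc r) k p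
moment-Dgo r k []       = refl
moment-Dgo r k (c ∷ cs) = cong₂ _+_
  (trans (sym (*-assoc (k ^ r) k c)) (cong (_* c) (*-comm (k ^ r) k)))
  (moment-Dgo r (suc k) cs)

moment-Dpow : ∀ s r p → moment s 0 (Dpow r p) ≡ moment (s + r) 0 p
moment-Dpow s zero    p = cong (λ t → moment t 0 p) (sym (+-identityʳ s))
moment-Dpow s (suc r) p = begin
  moment s 0 (Dgo 0 (Dpow r p)) ≡⟨ moment-Dgo s 0 (Dpow r p) ⟩
  moment (suc s) 0 (Dpow r p)   ≡⟨ moment-Dpow (suc s) r p ⟩
  moment (suc s + r) 0 p        ≡⟨ cong (λ t → moment t 0 p) (sym (+-suc s r)) ⟩
  moment (s + suc r) 0 p        ∎

eval1-Dpow : ∀ r p → eval1 (Dpow r p) ≡ moment r 0 p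
eval1-Dpow r p = trans (sum≡moment-zero 0 (Dpow r p)) (moment-Dpow 0 r p)

moment-+p : ∀ r k p q → moment r k (p +p q) ≡ moment r k p + moment r k q
moment-+p r k []      q       = refl
moment-+p r k (a ∷ p) []      = sym (+-identityʳ _)
moment-+p r k (a ∷ p) (b ∷ q) = begin
  k ^ r * (a + b) + moment r (suc k) (p +p q)
    ≡⟨ cong₂ _+_ (*-distribˡ-+ (k ^ r) a b) (moment-+p r (suc k) p q) ⟩
  (k ^ r * a + k ^ r * b) + (moment r (suc k) p + moment r (suc k) q)
    ≡⟨ interchange (k ^ r * a) (k ^ r * b) (moment r (suc k) p) (moment r (suc k) q) ⟩
  (k ^ r * a + moment r (suc k) p) + (k ^ r * b + moment r (suc k) q) ∎

moment-qPow : ∀ r k δ p → moment r k (qPow δ p) ≡ moment r (k + toℕ δ) p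
moment-qPow r k true  p = begin
  k ^ r * 0 + moment r (suc k) p ≡⟨ cong (_+ moment r (suc k) p) (*-zeroʳ (k ^ r)) ⟩
  moment r (suc k) p             ≡⟨ cong (λ j → moment r j p) (+-comm 1 k) ⟩
  moment r (k + 1) p             ∎
moment-qPow r k false p = cong (λ j → moment r j p) (sym (+-identityʳ k))

moment-sumP : {A : Set} → ∀ r k (g : A → Poly) xs → moment r k (sumP (map g xs)) ≡ ∑[ x ∈ xs ] moment r k (g x)
moment-sumP r k g []       = refl
moment-sumP r k g (x ∷ xs) =
  trans (moment-+p r k (g x) (sumP (map g xs))) (cong (moment r k (g x) +_) (moment-sumP r k g xs))

+p-identityʳ : ∀ p → p +p [] ≡ p
+p-identityʳ []      = refl
+p-identityʳ (x ∷ p) = refl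

-- Sums over all words of a given length

sumWords : ℕ → (List Bool → ℕ) → ℕ
sumWords zero    f = f []
sumWords (suc m) f = sumWords m (f ∘ (true ∷_)) + sumWords m (f ∘ (false ∷_))

sumWords-cong : ∀ m {f g : List Bool → ℕ} → (∀ w → length w ≡ m → f w ≡ g w) → sumWords m f ≡ sumWords m g
sumWords-cong zero    f≡g = f≡g [] refl
sumWords-cong (suc m) f≡g = cong₂ _+_
  (sumWords-cong m (λ w len → f≡g (true ∷ w) (cong suc len)))
  (sumWords-cong m (λ w len → f≡g (false ∷ w) (cong suc len)))

sumWords-const : ∀ m c → sumWords m (λ _ → c) ≡ 2 ^ m * c
sumWords-const zero    c = sym (+-identityʳ c)
sumWords-const (suc m) c = begin
  sumWords m (λ _ → c) + sumWords m (λ _ → c) ≡⟨ cong₂ _+_ (sumWords-const m c) (sumWords-const m c) ⟩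
  2 ^ m * c + 2 ^ m * c                       ≡⟨ sym (*-distribʳ-+ c (2 ^ m) (2 ^ m)) ⟩
  (2 ^ m + 2 ^ m) * c                         ≡⟨ cong (λ x → (2 ^ m + x) * c) (sym (+-identityʳ (2 ^ m))) ⟩
  2 ^ suc m * c                               ∎

sumWords-∷ : ∀ b m f → sumWords (suc m) f ≡ sumWords m (f ∘ (b ∷_)) + sumWords m (f ∘ (not b ∷_))
sumWords-∷ true  m f = refl
sumWords-∷ false m f = +-comm (sumWords m (f ∘ (true ∷_))) (sumWords m (f ∘ (false ∷_)))

sumWords-∷ʳ : ∀ m f → sumWords (suc m) f ≡ sumWords m (f ∘ (_∷ʳ true)) + sumWords m (f ∘ (_∷ʳ false))
sumWords-∷ʳ zero    f = refl
sumWords-∷ʳ (suc m) f = begin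
  sumWords (suc m) (f ∘ (true ∷_)) + sumWords (suc m) (f ∘ (false ∷_))
    ≡⟨ cong₂ _+_ (sumWords-∷ʳ m (f ∘ (true ∷_))) (sumWords-∷ʳ m (f ∘ (false ∷_))) ⟩
  (tt + tf) + (ft + ff) ≡⟨ interchange tt tf ft ff ⟩
  (tt + ft) + (tf + ff) ∎
  where
  tt = sumWords m (λ w → f (true ∷ w ∷ʳ true))
  tf = sumWords m (λ w → f (true ∷ w ∷ʳ false))
  ft = sumWords m (λ w → f (false ∷ w ∷ʳ true))
  ff = sumWords m (λ w → f (false ∷ w ∷ʳ false))

sumWords-reverse : ∀ m f → sumWords m (f ∘ reverse) ≡ sumWords m f
sumWords-reverse zero    f = refl
sumWords-reverse (suc m) f = begin
  sumWords m (λ w → f (reverse (true ∷ w))) + sumWords m (λ w → f (reverse (false ∷ w)))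
    ≡⟨ cong₂ _+_ (reversed true) (reversed false) ⟩
  sumWords m (f ∘ (_∷ʳ true)) + sumWords m (f ∘ (_∷ʳ false))
    ≡⟨ sym (sumWords-∷ʳ m f) ⟩
  sumWords (suc m) f ∎
  where
  reversed : ∀ x → sumWords m (λ w → f (reverse (x ∷ w))) ≡ sumWords m (f ∘ (_∷ʳ x))
  reversed x = trans (sumWords-cong m (λ w _ → cong f (unfold-reverse x w)))
                     (sumWords-reverse m (f ∘ (_∷ʳ x)))

sumWords-take : ∀ n h g → h ≤ n → sumWords n (g ∘ take h) ≡ 2 ^ (n ∸ h) * sumWords h g
sumWords-take n       zero    g _         = sumWords-const n (g [])
sumWords-take (suc n) (suc h) g (s≤s h≤n) = begin
  sumWords n (g ∘ (true ∷_) ∘ take h) + sumWords n (g ∘ (false ∷_) ∘ take h)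
    ≡⟨ cong₂ _+_ (sumWords-take n h (g ∘ (true ∷_)) h≤n) (sumWords-take n h (g ∘ (false ∷_)) h≤n) ⟩
  2 ^ (n ∸ h) * sumWords h (g ∘ (true ∷_)) + 2 ^ (n ∸ h) * sumWords h (g ∘ (false ∷_))
    ≡⟨ sym (*-distribˡ-+ (2 ^ (n ∸ h)) _ _) ⟩
  2 ^ (n ∸ h) * sumWords (suc h) g ∎

sumWords-drop : ∀ n h g → h ≤ n → sumWords n (g ∘ drop h) ≡ 2 ^ h * sumWords (n ∸ h) g
sumWords-drop n       zero    g _         = sym (*-identityˡ _)
sumWords-drop (suc n) (suc h) g (s≤s h≤n) = begin
  sumWords n (g ∘ drop h) + sumWords n (g ∘ drop h)
    ≡⟨ cong₂ _+_ (sumWords-drop n h g h≤n) (sumWords-drop n h g h≤n) ⟩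
  2 ^ h * X + 2 ^ h * X ≡⟨ sym (*-distribʳ-+ X (2 ^ h) (2 ^ h)) ⟩
  (2 ^ h + 2 ^ h) * X   ≡⟨ cong (λ y → (2 ^ h + y) * X) (sym (+-identityʳ (2 ^ h))) ⟩
  2 ^ suc h * X         ∎
  where X = sumWords (n ∸ h) g

sumWords-∑ : {A : Set} → ∀ m (xs : List A) (F : A → List Bool → ℕ) →
  sumWords m (λ w → ∑[ x ∈ xs ] F x w) ≡ ∑[ x ∈ xs ] sumWords m (F x)
sumWords-∑ zero    xs F = refl
sumWords-∑ (suc m) xs F = begin
  sumWords m (λ w → ∑[ x ∈ xs ] F x (true ∷ w)) + sumWords m (λ w → ∑[ x ∈ xs ] F x (false ∷ w))
    ≡⟨ cong₂ _+_ (sumWords-∑ m xs (λ x → F x ∘ (true ∷_))) (sumWords-∑ m xs (λ x → F x ∘ (false ∷_))) ⟩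
  ∑[ x ∈ xs ] sumWords m (F x ∘ (true ∷_)) + ∑[ x ∈ xs ] sumWords m (F x ∘ (false ∷_))
    ≡⟨ sym (∑-+ xs _ _) ⟩
  ∑[ x ∈ xs ] sumWords (suc m) (F x) ∎

∑-allSubsets : ∀ m (f : List Bool → ℕ) → ∑[ S ∈ allSubsets m ] f (toList S) ≡ sumWords m f
∑-allSubsets zero    f = +-identityʳ (f [])
∑-allSubsets (suc m) f = begin
  ∑ (map (true Vec.∷_) (allSubsets m) ++ map (false Vec.∷_) (allSubsets m)) (f ∘ toList)
    ≡⟨ ∑-++ (map (true Vec.∷_) (allSubsets m)) _ (f ∘ toList) ⟩
  ∑ (map (true Vec.∷_) (allSubsets m)) (f ∘ toList) + ∑ (map (false Vec.∷_) (allSubsets m)) (f ∘ toList)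
    ≡⟨ cong₂ _+_ (∑-map (true Vec.∷_) (allSubsets m) (f ∘ toList)) (∑-map (false Vec.∷_) (allSubsets m) (f ∘ toList)) ⟩
  ∑[ S ∈ allSubsets m ] f (true ∷ toList S) + ∑[ S ∈ allSubsets m ] f (false ∷ toList S)
    ≡⟨ cong₂ _+_ (∑-allSubsets m (f ∘ (true ∷_))) (∑-allSubsets m (f ∘ (false ∷_))) ⟩
  sumWords (suc m) f ∎

sumWords-zero : ∀ m {f : List Bool → ℕ} → (∀ w → length w ≡ m → f w ≡ 0) → sumWords m f ≡ 0
sumWords-zero m f≡0 = trans (sumWords-cong m f≡0) (trans (sumWords-const m 0) (*-zeroʳ (2 ^ m)))

-- Marked letters and the polynomials G̃

isLetter : Bool → Bool → Bool
isLetter b x = if b then x else not x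

isLetter-refl : ∀ b → isLetter b b ≡ true
isLetter-refl true  = refl
isLetter-refl false = refl

countB-≤-length : ∀ b w → countB b w ≤ length w
countB-≤-length b []      = z≤n
countB-≤-length b (x ∷ w) with isLetter b x
... | true  = s≤s (countB-≤-length b w)
... | false = m≤n⇒m≤1+n (countB-≤-length b w)

-- Reading w from the right, the i-th letter is marked when it is a b and
-- it is the (⌊i/2⌋+1)-th b read so far: a correct guess g(i) in the pile of b's.
marks : Bool → List Bool → ℕ
marks b []      = 0
marks b (x ∷ w) = toℕ (isLetter b x ∧ (countB b w ≡ᵇ ⌊ suc (length w) /2⌋)) + marks b w

marks-marked : ∀ b {a} c w → countB b w ≡ a → length w ≡ a + c →
  marks b (b ∷ w) ≡ toℕ (δc (suc a) c) + marks b w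
marks-marked b {a} c w count len = cong (λ z → toℕ z + marks b w) (begin
  isLetter b b ∧ (countB b w ≡ᵇ ⌊ suc (length w) /2⌋)
    ≡⟨ cong₂ _∧_ (isLetter-refl b) (cong₂ (λ x y → x ≡ᵇ ⌊ suc y /2⌋) count len) ⟩
  a ≡ᵇ ⌊ suc (a + c) /2⌋ ≡⟨ ≡ᵇ-sym a ⌊ suc (a + c) /2⌋ ⟩
  ⌊ suc (a + c) /2⌋ ≡ᵇ a ≡⟨ cong (_≡ᵇ suc a) (+-comm 1 ⌊ suc (a + c) /2⌋) ⟩
  δc (suc a) c          ∎)

momentTerm : Bool → ℕ → ℕ → ℕ → List Bool → ℕ
momentTerm b r k a w = if countB b w ≡ᵇ a then (k + marks b w) ^ r else 0

momentTerm-marked : ∀ b r k a c w → length w ≡ a + c →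
  momentTerm b r k (suc a) (b ∷ w) ≡ momentTerm b r (k + toℕ (δc (suc a) c)) a w
momentTerm-marked b r k a c w len =
  trans (cong (λ x → if x ≡ᵇ suc a then (k + marks b (b ∷ w)) ^ r else 0) (countB-marked b))
        (if-≡ᵇ-cong (countB b w) a (λ count → cong (_^ r) (begin
          k + marks b (b ∷ w)                ≡⟨ cong (k +_) (marks-marked b c w count len) ⟩
          k + (toℕ (δc (suc a) c) + marks b w) ≡⟨ sym (+-assoc k _ (marks b w)) ⟩
          k + toℕ (δc (suc a) c) + marks b w   ∎)))
  where
  countB-marked : ∀ b → countB b (b ∷ w) ≡ suc (countB b w)
  countB-marked true  = refl
  countB-marked false = refl

momentTerm-unmarked : ∀ b r k a w → momentTerm b r k a (not b ∷ w) ≡ momentTerm b r k a w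
momentTerm-unmarked true  r k a w = refl
momentTerm-unmarked false r k a w = refl

momentTerm-zero-marked : ∀ b r k w → momentTerm b r k 0 (b ∷ w) ≡ 0
momentTerm-zero-marked true  r k w = refl
momentTerm-zero-marked false r k w = refl

momentTerm-short : ∀ b r k a w → length w ≤ a → momentTerm b r k (suc a) w ≡ 0
momentTerm-short b r k a w len≤a
  rewrite <⇒≡ᵇ-false (s≤s (≤-trans (countB-≤-length b w) len≤a)) = refl

sumWords-momentTerm-suc : ∀ b r k a c →
  sumWords (suc (a + c)) (momentTerm b r k (suc a))
    ≡ sumWords (a + c) (momentTerm b r (k + toℕ (δc (suc a) c)) a) + sumWords (a + c) (momentTerm b r k (suc a))
sumWords-momentTerm-suc b r k a c = trans (sumWords-∷ b (a + c) (momentTerm b r k (suc a))) (cong₂ _+_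
  (sumWords-cong (a + c) (momentTerm-marked b r k a c))
  (sumWords-cong (a + c) (λ w _ → momentTerm-unmarked b r k (suc a) w)))

-- The recursion of G̃ is the decomposition of a word by its first letter.
moment-Gt : ∀ b r k a c → moment r k (Gt a c) ≡ sumWords (a + c) (momentTerm b r k a)
moment-Gt b r k zero    zero    = begin
  k ^ r * 1 + 0 ≡⟨ +-identityʳ (k ^ r * 1) ⟩
  k ^ r * 1     ≡⟨ *-identityʳ (k ^ r) ⟩
  k ^ r         ≡⟨ cong (_^ r) (sym (+-identityʳ k)) ⟩
  (k + 0) ^ r   ∎
moment-Gt b r k zero    (suc c) = begin
  moment r k (Gt zero c)           ≡⟨ moment-Gt b r k zero c ⟩
  0 + sumWords c (momentTerm b r k 0)
    ≡⟨ sym (cong₂ _+_ (sumWords-zero c (λ w _ → momentTerm-zero-marked b r k w))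
                      (sumWords-cong c (λ w _ → momentTerm-unmarked b r k 0 w))) ⟩
  sumWords c (momentTerm b r k 0 ∘ (b ∷_)) + sumWords c (momentTerm b r k 0 ∘ (not b ∷_))
    ≡⟨ sym (sumWords-∷ b c (momentTerm b r k 0)) ⟩
  sumWords (suc c) (momentTerm b r k 0) ∎
moment-Gt b r k (suc a) zero    = begin
  moment r k (qPow δ (Gt a 0) +p [])   ≡⟨ moment-+p r k (qPow δ (Gt a 0)) [] ⟩
  moment r k (qPow δ (Gt a 0)) + 0
    ≡⟨ cong₂ _+_ (trans (moment-qPow r k δ (Gt a 0)) (moment-Gt b r (k + toℕ δ) a 0))
                 (sym (sumWords-zero (a + 0) (λ w len → momentTerm-short b r k a w (≤-reflexive (trans len (+-identityʳ a)))))) ⟩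
  sumWords (a + 0) (momentTerm b r (k + toℕ δ) a) + sumWords (a + 0) (momentTerm b r k (suc a))
    ≡⟨ sym (sumWords-momentTerm-suc b r k a 0) ⟩
  sumWords (suc a + 0) (momentTerm b r k (suc a)) ∎
  where δ = δc (suc a) 0
moment-Gt b r k (suc a) (suc c) = begin
  moment r k (qPow δ (Gt a (suc c)) +p Gt (suc a) c)
    ≡⟨ moment-+p r k (qPow δ (Gt a (suc c))) (Gt (suc a) c) ⟩
  moment r k (qPow δ (Gt a (suc c))) + moment r k (Gt (suc a) c)
    ≡⟨ cong₂ _+_ (trans (moment-qPow r k δ (Gt a (suc c))) (moment-Gt b r (k + toℕ δ) a (suc c)))
                 (moment-Gt b r k (suc a) c) ⟩
  sumWords (a + suc c) (momentTerm b r (k + toℕ δ) a) + sumWords (suc a + c) (momentTerm b r k (suc a))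
    ≡⟨ cong (λ m → sumWords (a + suc c) (momentTerm b r (k + toℕ δ) a) + sumWords m (momentTerm b r k (suc a)))
            (sym (+-suc a c)) ⟩
  sumWords (a + suc c) (momentTerm b r (k + toℕ δ) a) + sumWords (a + suc c) (momentTerm b r k (suc a))
    ≡⟨ sym (sumWords-momentTerm-suc b r k a (suc c)) ⟩
  sumWords (suc a + suc c) (momentTerm b r k (suc a)) ∎
  where δ = δc (suc a) (suc c)

eval1-Dpow-∑Gt : ∀ b r m →
  eval1 (Dpow r (sumP (map (λ a → Gt a (m ∸ a)) (upTo (suc m))))) ≡ sumWords m (λ w → marks b w ^ r)
eval1-Dpow-∑Gt b r m = begin
  eval1 (Dpow r P)                                    ≡⟨ eval1-Dpow r P ⟩
  moment r 0 P                                        ≡⟨ moment-sumP r 0 (λ a → Gt a (m ∸ a)) (upTo (suc m)) ⟩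
  ∑[ a ∈ upTo (suc m) ] moment r 0 (Gt a (m ∸ a))     ≡⟨ ∑-congᴬ (All.map moment-Gt-∸ (all-upTo (suc m))) ⟩
  ∑[ a ∈ upTo (suc m) ] sumWords m (momentTerm b r 0 a) ≡⟨ sym (sumWords-∑ m (upTo (suc m)) (momentTerm b r 0)) ⟩
  sumWords m (λ w → ∑[ a ∈ upTo (suc m) ] momentTerm b r 0 a w)
    ≡⟨ sumWords-cong m (λ w len → ∑-upTo-select m (λ _ → marks b w ^ r)
                                    (subst (countB b w ≤_) len (countB-≤-length b w))) ⟩
  sumWords m (λ w → marks b w ^ r)                     ∎
  where
  P = sumP (map (λ a → Gt a (m ∸ a)) (upTo (suc m)))
  moment-Gt-∸ : ∀ {a} → a < suc m → moment r 0 (Gt a (m ∸ a)) ≡ sumWords m (momentTerm b r 0 a)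
  moment-Gt-∸ {a} a<1+m = trans (moment-Gt b r 0 a (m ∸ a))
                                (cong (λ n → sumWords n (momentTerm b r 0 a)) (m+[n∸m]≡n (≤-pred a<1+m)))

-- The one-shuffle statistics as marks of a prefix and of a suffix

card-≤ : ∀ {n} (S : Vec Bool n) → card S ≤ n
card-≤ S = subst (card S ≤_) (length-toList S) (countB-≤-length true (toList S))

C≡∑-card : ∀ n W → C n W ≡ ∑[ S ∈ allSubsets n ] W (card S) S
C≡∑-card n W = trans (∑-swap (upTo (suc n)) (allSubsets n) (λ t S → if card S ≡ᵇ t then W t S else 0))
                     (∑-cong (allSubsets n) (λ S → ∑-upTo-select n (λ t → W t S) (card-≤ S)))

countB-++ : ∀ b xs ys → countB b (xs ++ ys) ≡ countB b xs + countB b ys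
countB-++ b []       ys = refl
countB-++ b (x ∷ xs) ys =
  trans (cong (toℕ (isLetter b x) +_) (countB-++ b xs ys)) (sym (+-assoc (toℕ (isLetter b x)) _ _))

countB-reverse : ∀ b w → countB b (reverse w) ≡ countB b w
countB-reverse b []      = refl
countB-reverse b (x ∷ w) = begin
  countB b (reverse (x ∷ w))                   ≡⟨ cong (countB b) (unfold-reverse x w) ⟩
  countB b (reverse w ∷ʳ x)                    ≡⟨ countB-++ b (reverse w) (x ∷ []) ⟩
  countB b (reverse w) + (toℕ (isLetter b x) + 0) ≡⟨ cong₂ _+_ (countB-reverse b w) (+-identityʳ _) ⟩
  countB b w + toℕ (isLetter b x)              ≡⟨ +-comm (countB b w) _ ⟩
  countB b (x ∷ w)                             ∎

length≡countB+countB : ∀ w → length w ≡ countB true w + countB false w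
length≡countB+countB []          = refl
length≡countB+countB (true ∷ w)  = cong suc (length≡countB+countB w)
length≡countB+countB (false ∷ w) = trans (cong suc (length≡countB+countB w)) (sym (+-suc _ _))

nth-++-length : ∀ u (x : Bool) v → nth (u ++ x ∷ v) (length u) ≡ x
nth-++-length []      x v = refl
nth-++-length (y ∷ u) x v = nth-++-length u x v

take-suc-++-length : {A : Set} (u : List A) (x : A) (v : List A) → take (suc (length u)) (u ++ x ∷ v) ≡ u ∷ʳ x
take-suc-++-length []      x v = refl
take-suc-++-length (y ∷ u) x v = cong (y ∷_) (take-suc-++-length u x v)

length-take-≤ : ∀ h (L : List Bool) → h ≤ length L → length (take h L) ≡ h
length-take-≤ h L h≤ = trans (length-take h L) (m≤n⇒m⊓n≡m h≤)

prefixMatch : List Bool → ℕ → Bool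
prefixMatch L i = nth L (i ∸ 1) ∧ (countB true (take i L) ≡ᵇ gA i)

∑-prefixMatch : ∀ v R → ∑[ i ∈ applyUpTo suc (length v) ] toℕ (prefixMatch (reverse v ++ R) i) ≡ marks true v
∑-prefixMatch []      R = refl
∑-prefixMatch (x ∷ v) R = begin
  ∑[ i ∈ applyUpTo suc (suc l) ] toℕ (prefixMatch (reverse (x ∷ v) ++ R) i)
    ≡⟨ cong₂ (λ L is → ∑[ i ∈ is ] toℕ (prefixMatch L i)) reorder (sym (applyUpTo-∷ʳ suc l)) ⟩
  ∑[ i ∈ applyUpTo suc l ∷ʳ suc l ] toℕ (prefixMatch L i)
    ≡⟨ ∑-++ (applyUpTo suc l) (suc l ∷ []) (toℕ ∘ prefixMatch L) ⟩
  ∑[ i ∈ applyUpTo suc l ] toℕ (prefixMatch L i) + (toℕ (prefixMatch L (suc l)) + 0)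
    ≡⟨ cong₂ _+_ (∑-prefixMatch v (x ∷ R)) (trans (+-identityʳ _) (cong toℕ last)) ⟩
  marks true v + toℕ (x ∧ (countB true v ≡ᵇ ⌊ suc l /2⌋))
    ≡⟨ +-comm (marks true v) _ ⟩
  marks true (x ∷ v) ∎
  where
  l = length v
  L = reverse v ++ x ∷ R
  reorder : reverse (x ∷ v) ++ R ≡ L
  reorder = trans (cong (_++ R) (unfold-reverse x v)) (∷ʳ-++ (reverse v) x R)
  appended : ∀ x → x ∧ (countB true (reverse v ∷ʳ x) ≡ᵇ gA (suc l)) ≡ x ∧ (countB true v ≡ᵇ ⌊ suc l /2⌋)
  appended false = refl
  appended true  = cong₂ _≡ᵇ_
    (trans (countB-++ true (reverse v) (true ∷ [])) (trans (cong (_+ 1) (countB-reverse true v)) (+-comm _ 1)))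
    (+-comm ⌊ suc l /2⌋ 1)
  last : prefixMatch L (suc l) ≡ x ∧ (countB true v ≡ᵇ ⌊ suc l /2⌋)
  last = begin
    nth L l ∧ (countB true (take (suc l) L) ≡ᵇ gA (suc l))
      ≡⟨ cong (λ j → nth L j ∧ (countB true (take (suc j) L) ≡ᵇ gA (suc l))) (sym (length-reverse v)) ⟩
    nth L (length (reverse v)) ∧ (countB true (take (suc (length (reverse v))) L) ≡ᵇ gA (suc l))
      ≡⟨ cong₂ (λ y w → y ∧ (countB true w ≡ᵇ gA (suc l)))
               (nth-++-length (reverse v) x R) (take-suc-++-length (reverse v) x R) ⟩
    x ∧ (countB true (reverse v ∷ʳ x) ≡ᵇ gA (suc l)) ≡⟨ appended x ⟩
    x ∧ (countB true v ≡ᵇ ⌊ suc l /2⌋) ∎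

YA≡marks : ∀ n (S : Vec Bool n) → YA n (card S) S ≡ marks true (reverse (take (hh n) (toList S)))
YA≡marks n S = begin
  YA n (card S) S
    ≡⟨ count≡∑ _ (applyUpTo suc h) ⟩
  ∑[ i ∈ applyUpTo suc h ] toℕ (inS S i ∧ (perm (card S) S i ≡ᵇ gA i))
    ≡⟨ ∑-cong (applyUpTo suc h) (cong toℕ ∘ matches) ⟩
  ∑[ i ∈ applyUpTo suc h ] toℕ (prefixMatch L i)
    ≡⟨ cong₂ (λ m L → ∑[ i ∈ applyUpTo suc m ] toℕ (prefixMatch L i)) (sym length-v) split ⟩
  ∑[ i ∈ applyUpTo suc (length v) ] toℕ (prefixMatch (reverse v ++ drop h L) i)
    ≡⟨ ∑-prefixMatch v (drop h L) ⟩
  marks true v ∎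
  where
  h = hh n
  L = toList S
  v = reverse (take h L)
  matches : ∀ i → inS S i ∧ (perm (card S) S i ≡ᵇ gA i) ≡ prefixMatch L i
  matches i with nth L (i ∸ 1)
  ... | true  = refl
  ... | false = refl
  length-v : length v ≡ h
  length-v = trans (length-reverse (take h L))
                   (length-take-≤ h L (subst (h ≤_) (sym (length-toList S)) (⌈n/2⌉≤n n)))
  split : L ≡ reverse v ++ drop h L
  split = sym (trans (cong (_++ drop h L) (reverse-involutive (take h L))) (take++drop≡id h L))

suffixMatch : List Bool → ℕ → Bool
suffixMatch L j =
  not (nth L (j ∸ 1)) ∧ (countB true L + countB false (take j L) ≡ᵇ length L ∸ ⌊ (length L + 1 ∸ j) /2⌋)

suffixMatch-head : ∀ u x v →
  suffixMatch (u ++ x ∷ v) (length u + 1) ≡ not x ∧ (countB false v ≡ᵇ ⌊ suc (length v) /2⌋)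
suffixMatch-head u x v = begin
  not (nth L (length u + 1 ∸ 1)) ∧ (countB true L + countB false (take (length u + 1) L) ≡ᵇ N ∸ ⌊ (N + 1 ∸ (length u + 1)) /2⌋)
    ≡⟨ cong₂ (λ y z → not y ∧ z)
             (trans (cong (nth L) (m+n∸n≡m (length u) 1)) (nth-++-length u x v))
             (cong₂ (λ w m → countB true L + countB false w ≡ᵇ N ∸ ⌊ m /2⌋) prefix suffix-length) ⟩
  not x ∧ (A ≡ᵇ N ∸ F) ≡⟨ cong (not x ∧_) (≡ᵇ-cong-⇔ {A} {N ∸ F} {X} {F} ⇒ ⇐) ⟩
  not x ∧ (X ≡ᵇ F)     ∎
  where
  L = u ++ x ∷ v
  N = length L
  A = countB true L + countB false (u ∷ʳ x)
  X = countB false v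
  F = ⌊ suc (length v) /2⌋
  prefix : take (length u + 1) L ≡ u ∷ʳ x
  prefix = trans (cong (λ j → take j L) (+-comm (length u) 1)) (take-suc-++-length u x v)
  suffix-length : N + 1 ∸ (length u + 1) ≡ suc (length v)
  suffix-length = begin
    N + 1 ∸ (length u + 1)          ≡⟨ cong₂ _∸_ (+-comm N 1) (+-comm (length u) 1) ⟩
    N ∸ length u                    ≡⟨ cong (_∸ length u) (length-++ u) ⟩
    length u + suc (length v) ∸ length u ≡⟨ m+n∸m≡n (length u) (suc (length v)) ⟩
    suc (length v)                  ∎
  A+X≡N : A + X ≡ N
  A+X≡N = begin
    countB true L + countB false (u ∷ʳ x) + X     ≡⟨ +-assoc (countB true L) _ X ⟩
    countB true L + (countB false (u ∷ʳ x) + X)   ≡⟨ cong (countB true L +_) (sym (countB-++ false (u ∷ʳ x) v)) ⟩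
    countB true L + countB false ((u ∷ʳ x) ++ v)  ≡⟨ cong (λ w → countB true L + countB false w) (∷ʳ-++ u x v) ⟩
    countB true L + countB false L                ≡⟨ sym (length≡countB+countB L) ⟩
    N                                             ∎
  F≤N : F ≤ N
  F≤N = ≤-trans (⌊n/2⌋≤n (suc (length v))) (subst (suc (length v) ≤_) (sym (length-++ u)) (m≤n+m _ (length u)))
  ⇒ : A ≡ N ∸ F → X ≡ F
  ⇒ A≡ = begin
    X            ≡⟨ sym (m+n∸m≡n A X) ⟩
    A + X ∸ A    ≡⟨ cong₂ _∸_ A+X≡N A≡ ⟩
    N ∸ (N ∸ F)  ≡⟨ m∸[m∸n]≡n F≤N ⟩
    F            ∎
  ⇐ : X ≡ F → A ≡ N ∸ F
  ⇐ X≡ = trans (sym (m+n∸n≡m A X)) (cong₂ _∸_ A+X≡N X≡)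

∑-suffixMatch : ∀ u v →
  ∑[ j ∈ applyUpTo (λ k → length u + suc k) (length v) ] toℕ (suffixMatch (u ++ v) j) ≡ marks false v
∑-suffixMatch u []      = refl
∑-suffixMatch u (x ∷ v) = cong₂ _+_ (cong toℕ (suffixMatch-head u x v)) (begin
  ∑[ j ∈ applyUpTo (λ k → length u + suc (suc k)) (length v) ] toℕ (suffixMatch (u ++ x ∷ v) j)
    ≡⟨ cong₂ (λ js L → ∑[ j ∈ js ] toℕ (suffixMatch L j))
             (applyUpTo-cong shift (length v)) (sym (∷ʳ-++ u x v)) ⟩
  ∑[ j ∈ applyUpTo (λ k → length (u ∷ʳ x) + suc k) (length v) ] toℕ (suffixMatch ((u ∷ʳ x) ++ v) j)
    ≡⟨ ∑-suffixMatch (u ∷ʳ x) v ⟩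
  marks false v ∎)
  where
  shift : ∀ k → length u + suc (suc k) ≡ length (u ∷ʳ x) + suc k
  shift k = sym (trans (cong (_+ suc k) (length-++ u)) (+-assoc (length u) 1 (suc k)))

ZB≡marks : ∀ n (S : Vec Bool n) → ZB n (card S) S ≡ marks false (drop (hh n) (toList S))
ZB≡marks n S = begin
  ZB n (card S) S
    ≡⟨ count≡∑ _ (applyUpTo (λ k → h + suc k) (n ∸ h)) ⟩
  ∑[ j ∈ applyUpTo (λ k → h + suc k) (n ∸ h) ] toℕ (not (inS S j) ∧ (perm (card S) S j ≡ᵇ gB n j))
    ≡⟨ ∑-cong (applyUpTo (λ k → h + suc k) (n ∸ h)) (cong toℕ ∘ matches) ⟩
  ∑[ j ∈ applyUpTo (λ k → h + suc k) (n ∸ h) ] toℕ (suffixMatch L j)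
    ≡⟨ cong₂ (λ js L → ∑[ j ∈ js ] toℕ (suffixMatch L j))
             (cong₂ (λ a m → applyUpTo (λ k → a + suc k) m) (sym length-u) (sym length-v))
             (sym (take++drop≡id h L)) ⟩
  ∑[ j ∈ applyUpTo (λ k → length u + suc k) (length v) ] toℕ (suffixMatch (u ++ v) j)
    ≡⟨ ∑-suffixMatch u v ⟩
  marks false v ∎
  where
  h = hh n
  L = toList S
  u = take h L
  v = drop h L
  matches : ∀ j → not (inS S j) ∧ (perm (card S) S j ≡ᵇ gB n j) ≡ suffixMatch L j
  matches j rewrite length-toList S with nth L (j ∸ 1)
  ... | true  = refl
  ... | false = refl
  length-u : length u ≡ h
  length-u = length-take-≤ h L (subst (h ≤_) (sym (length-toList S)) (⌈n/2⌉≤n n))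
  length-v : length v ≡ n ∸ h
  length-v = trans (length-drop h L) (cong (_∸ h) (length-toList S))

YA-moments : ∀ n r → C n (λ t S → YA n t S ^ r) ≡ 2 ^ (n ∸ hh n) * eval1 (Dpow r (FA n))
YA-moments n r = begin
  C n (λ t S → YA n t S ^ r)
    ≡⟨ C≡∑-card n (λ t S → YA n t S ^ r) ⟩
  ∑[ S ∈ allSubsets n ] (YA n (card S) S ^ r)
    ≡⟨ ∑-cong (allSubsets n) (λ S → cong (_^ r) (YA≡marks n S)) ⟩
  ∑[ S ∈ allSubsets n ] (marks true (reverse (take h (toList S))) ^ r)
    ≡⟨ ∑-allSubsets n (λ w → marks true (reverse (take h w)) ^ r) ⟩
  sumWords n (λ w → marks true (reverse (take h w)) ^ r)
    ≡⟨ sumWords-take n h (λ w → marks true (reverse w) ^ r) (⌈n/2⌉≤n n) ⟩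
  2 ^ (n ∸ h) * sumWords h (λ w → marks true (reverse w) ^ r)
    ≡⟨ cong (2 ^ (n ∸ h) *_) (sumWords-reverse h (λ w → marks true w ^ r)) ⟩
  2 ^ (n ∸ h) * sumWords h (λ w → marks true w ^ r)
    ≡⟨ cong (2 ^ (n ∸ h) *_) (sym (eval1-Dpow-∑Gt true r h)) ⟩
  2 ^ (n ∸ h) * eval1 (Dpow r (FA n)) ∎
  where h = hh n

ZB-moments : ∀ n r → C n (λ t S → ZB n t S ^ r) ≡ 2 ^ hh n * eval1 (Dpow r (FB n))
ZB-moments n r = begin
  C n (λ t S → ZB n t S ^ r)
    ≡⟨ C≡∑-card n (λ t S → ZB n t S ^ r) ⟩
  ∑[ S ∈ allSubsets n ] (ZB n (card S) S ^ r)
    ≡⟨ ∑-cong (allSubsets n) (λ S → cong (_^ r) (ZB≡marks n S)) ⟩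
  ∑[ S ∈ allSubsets n ] (marks false (drop h (toList S)) ^ r)
    ≡⟨ ∑-allSubsets n (λ w → marks false (drop h w) ^ r) ⟩
  sumWords n (λ w → marks false (drop h w) ^ r)
    ≡⟨ sumWords-drop n h (λ w → marks false w ^ r) (⌈n/2⌉≤n n) ⟩
  2 ^ h * sumWords (n ∸ h) (λ w → marks false w ^ r)
    ≡⟨ cong (2 ^ h *_) (sym (eval1-Dpow-∑Gt false r (n ∸ h))) ⟩
  2 ^ h * eval1 (Dpow r (FB n)) ∎
  where h = hh n

-- The identities also hold for n = 0.
corollary2 : (n : ℕ) → 1 ≤ n → (r : ℕ) →
    (C n (λ t S → YA n t S ^ r) ≡ 2 ^ (n ∸ hh n) * eval1 (Dpow r (FA n)))
    × (C n (λ t S → ZB n t S ^ r) ≡ 2 ^ hh n * eval1 (Dpow r (FB n)))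
corollary2 n _ r = YA-moments n r , ZB-moments n r
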